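{- Let $X$ be a finitely generated abelian group and $S$ a finite symmetric generating set of $X$ (i.e. $s\in S\Rightarrow s^{ -1}\in S$, and the identity is not in $S$). Let $G$ be the Cayley graph of $X$ with respect to $S$, with vertex set $X$ and edges $\{g,gs\}$ for $g\in X$, $s\in S$. Then $\mathrm{Ric}(G)\ge 0$.
   Context: For a graph $G=(V,E)$ (undirected, simple, locally finite, no isolated vertices; $y\sim x$ means adjacency) and $f,g:V\to\mathbb R$ define $\Delta f(x)=\sum_{y\sim x}(f(y)-f(x))$, $\Gamma(f,g)(x)=\frac12\sum_{y\sim x}(f(x)-f(y))(g(x)-g(y))$, $\Gamma(f)=\Gamma(f,f)$, $\Gamma_2(f)=\frac12\Delta\Gamma(f)-\Gamma(f,\Delta f)$. "$\mathrm{Ric}(G)\ge K$" means $\Gamma_2(f)(x)\ge K\,\Gamma(f)(x)$ for all $f:V\to\mathbb R$ and all $x\in V$.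
   Formalization: The test functions f in the definition of $\mathrm{Ric}(G)\ge 0$ take values in ℚ instead of ℝ. -}

module Defs where

open import Data.List using (List; map; foldr)
open import Data.List.Relation.Unary.All using (All)
open import Data.List.Membership.Propositional using (_∈_)
open import Data.Product using (∃; _×_)
open import Data.Rational using (ℚ; _+_; _*_; _-_; _≤_; 0ℚ; ½)
open import Relation.Binary.PropositionalEquality using (_≡_)

sumℚ : List ℚ → ℚ
sumℚ = foldr _+_ 0ℚ

-- A locally finite graph given by its (duplicate-free) neighbour lists:
-- y ∼ x  iff  y occurs in nbrs x.
record Graph : Set₁ where
  field
    V    : Set
    nbrs : V → List V
open Graph public

Δ : (G : Graph) → (V G → ℚ) → V G → ℚ
Δ G f x = sumℚ (map (λ y → f y - f x) (nbrs G x))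

Γ : (G : Graph) → (V G → ℚ) → (V G → ℚ) → V G → ℚ
Γ G f g x = ½ * sumℚ (map (λ y → (f x - f y) * (g x - g y)) (nbrs G x))

Γ₂ : (G : Graph) → (V G → ℚ) → V G → ℚ
Γ₂ G f x = ½ * Δ G (Γ G f f) x - Γ G f (Δ G f) x

Ric≥ : Graph → ℚ → Set
Ric≥ G K = ∀ (f : V G → ℚ) (x : V G) → K * Γ G f f x ≤ Γ₂ G f x

Cayley : {X : Set} → (X → X → X) → List X → Graph
Cayley {X} _∙_ S = record { V = X ; nbrs = λ g → map (g ∙_) S }

-- S generates X: every element is a finite product of elements of S
-- (S symmetric, so words in S ∪ S⁻¹ are words in S).
Generates : {X : Set} → (X → X → X) → X → List X → Set
Generates {X} _∙_ ε S = ∀ (x : X) → ∃ λ (w : List X) → All (_∈ S) w × foldr _∙_ ε w ≡ x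

-- Around a vertex x of a Cayley graph, Γ₂ f x only involves the values of f at x,
-- at the neighbours x s and at the two-step neighbours x s t (s, t ∈ S). Written out,
-- it is a double sum over s and t of a quadratic expression in f x, f (x s), f (x t)
-- and f (x s t). When the group is abelian, x s t = x t s, and the (s, t) and (t, s)
-- terms add up to the square of the mixed second difference
-- f (x s t) − f (x s) − f (x t) + f x, so that
--   Γ₂ f x = ¼ Σ_{s,t ∈ S} (f (x s t) − f (x s) − f (x t) + f x)² ≥ 0.
module Submission where

open import Defs
open import Algebra.Bundles using (CommutativeSemigroup; CommutativeMonoid; Ring)
open import Algebra.Structures using (IsAbelianGroup)
import Algebra.Properties.CommutativeSemigroup as CommutativeSemigroupProperties
open import Data.List using (List; []; _∷_; map)
open import Data.List.Properties using (map-∘)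
open import Data.List.Membership.Propositional using (_∈_)
open import Data.List.Relation.Unary.Unique.Propositional using (Unique)
open import Data.Rational using (ℚ; 0ℚ; ½; _+_; _*_; _-_; -_; _≤_; nonNegative; nonPositive)
open import Data.Rational.Properties
  using (+-0-commutativeMonoid; +-*-ring; +-*-commutativeRing; _≟_; +-identityˡ; neg-distrib-+;
         *-distribˡ-+; *-zeroˡ; *-zeroʳ; ≤-refl; ≤-total; +-mono-≤; *-monoˡ-≤-nonNeg;
         nonNegative⁻¹; nonNeg*nonNeg⇒nonNeg; nonPos*nonPos⇒nonPos)
open import Data.Sum using (inj₁; inj₂)
open import Level using (0ℓ)
open import Relation.Binary.PropositionalEquality
  using (_≡_; refl; sym; trans; cong; cong₂; subst; module ≡-Reasoning)
open import Relation.Nullary using (¬_)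
open import Relation.Nullary.Decidable.Core using (dec⇒maybe)
import Tactic.RingSolver.Core.AlmostCommutativeRing as ACR
open import Tactic.RingSolver using (solve-∀)

open CommutativeSemigroupProperties using (xy∙z≈xz∙y)
open CommutativeSemigroupProperties
  (CommutativeMonoid.commutativeSemigroup +-0-commutativeMonoid)
  using () renaming (interchange to +-interchange)
open import Algebra.Properties.RingWithoutOne (Ring.ringWithoutOne +-*-ring) using (x[y-z]≈xy-xz)

ℚ-ring : ACR.AlmostCommutativeRing 0ℓ 0ℓ
ℚ-ring = ACR.fromCommutativeRing +-*-commutativeRing (λ p → dec⇒maybe (0ℚ ≟ p))

∑ : {A : Set} → List A → (A → ℚ) → ℚ
∑ L g = sumℚ (map g L)

private
  variable
    A B : Set

∑-cong : (L : List A) {g h : A → ℚ} → (∀ a → g a ≡ h a) → ∑ L g ≡ ∑ L h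
∑-cong []      g≡h = refl
∑-cong (a ∷ L) g≡h = cong₂ _+_ (g≡h a) (∑-cong L g≡h)

∑-0 : (L : List A) → ∑ L (λ _ → 0ℚ) ≡ 0ℚ
∑-0 []      = refl
∑-0 (a ∷ L) = trans (+-identityˡ _) (∑-0 L)

∑-+ : (L : List A) (g h : A → ℚ) → ∑ L (λ a → g a + h a) ≡ ∑ L g + ∑ L h
∑-+ []      g h = refl
∑-+ (a ∷ L) g h =
  trans (cong (g a + h a +_) (∑-+ L g h)) (+-interchange (g a) (h a) (∑ L g) (∑ L h))

∑-neg : (L : List A) (g : A → ℚ) → ∑ L (λ a → - g a) ≡ - ∑ L g
∑-neg []      g = refl
∑-neg (a ∷ L) g = trans (cong (- g a +_) (∑-neg L g)) (sym (neg-distrib-+ (g a) (∑ L g)))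

∑-- : (L : List A) (g h : A → ℚ) → ∑ L (λ a → g a - h a) ≡ ∑ L g - ∑ L h
∑-- L g h = trans (∑-+ L g (λ a → - h a)) (cong (∑ L g +_) (∑-neg L h))

∑-*ˡ : (L : List A) (c : ℚ) (g : A → ℚ) → ∑ L (λ a → c * g a) ≡ c * ∑ L g
∑-*ˡ []      c g = sym (*-zeroʳ c)
∑-*ˡ (a ∷ L) c g = trans (cong (c * g a +_) (∑-*ˡ L c g)) (sym (*-distribˡ-+ c (g a) (∑ L g)))

∑-comm : (L : List A) (M : List B) (g : A → B → ℚ) →
         ∑ L (λ a → ∑ M (g a)) ≡ ∑ M (λ b → ∑ L (λ a → g a b))
∑-comm []      M g = sym (∑-0 M)
∑-comm (a ∷ L) M g =
  trans (cong (∑ M (g a) +_) (∑-comm L M g)) (sym (∑-+ M (g a) (λ b → ∑ L (λ a′ → g a′ b))))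

∑-nonNeg : (L : List A) {g : A → ℚ} → (∀ a → 0ℚ ≤ g a) → 0ℚ ≤ ∑ L g
∑-nonNeg []      0≤g = ≤-refl
∑-nonNeg (a ∷ L) 0≤g = +-mono-≤ (0≤g a) (∑-nonNeg L 0≤g)

∑∑-symmetrise : (L : List A) (h : A → A → ℚ) →
                ∑ L (λ s → ∑ L (h s)) ≡ ½ * ∑ L (λ s → ∑ L (λ t → h s t + h t s))
∑∑-symmetrise L h = begin
  U                                                ≡⟨ p≡½[p+p] U ⟩
  ½ * (U + U)                                      ≡⟨ cong (λ V → ½ * (U + V)) (∑-comm L L h) ⟩
  ½ * (U + ∑ L (λ s → ∑ L (λ t → h t s)))          ≡⟨ cong (½ *_) (sym (∑-+ L (λ s → ∑ L (h s)) _)) ⟩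
  ½ * ∑ L (λ s → ∑ L (h s) + ∑ L (λ t → h t s))    ≡⟨ cong (½ *_) (∑-cong L (λ s → sym (∑-+ L (h s) (λ t → h t s)))) ⟩
  ½ * ∑ L (λ s → ∑ L (λ t → h s t + h t s))        ∎
  where
  open ≡-Reasoning
  U : ℚ
  U = ∑ L (λ s → ∑ L (h s))
  p≡½[p+p] : ∀ p → p ≡ ½ * (p + p)
  p≡½[p+p] = solve-∀ ℚ-ring

0≤p*p : ∀ p → 0ℚ ≤ p * p
0≤p*p p with ≤-total 0ℚ p
... | inj₁ 0≤p = let instance _ = nonNegative 0≤p in nonNegative⁻¹ _ {{nonNeg*nonNeg⇒nonNeg p p}}
... | inj₂ p≤0 = let instance _ = nonPositive p≤0 in nonNegative⁻¹ _ {{nonPos*nonPos⇒nonPos p p}}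

-- With a = f x, b = f (x s), c = f (x t), w = f (x s t): the first two terms come
-- from ½ Δ Γ(f), the last one from Γ(f, Δ f).
Γ₂-summand : ℚ → ℚ → ℚ → ℚ → ℚ
Γ₂-summand a b c w = ½ * ((b - w) * (b - w)) - ½ * ((a - c) * (a - c)) - (a - b) * ((c - a) - (w - b))

Γ₂-summand-symmetrised : ∀ a b c w →
  Γ₂-summand a b c w + Γ₂-summand a c b w ≡ (w - b - c + a) * (w - b - c + a)
Γ₂-summand-symmetrised = expanded
  where
  -- solve-∀ does not unfold Γ₂-summand, so the identity is stated expanded.
  expanded : ∀ a b c w →
    (½ * ((b - w) * (b - w)) - ½ * ((a - c) * (a - c)) - (a - b) * ((c - a) - (w - b)))
    + (½ * ((c - w) * (c - w)) - ½ * ((a - b) * (a - b)) - (a - c) * ((b - a) - (w - c)))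
    ≡ (w - b - c + a) * (w - b - c + a)
  expanded = solve-∀ ℚ-ring

Ric≥0⇐0≤Γ₂ : (G : Graph) → (∀ f x → 0ℚ ≤ Γ₂ G f x) → Ric≥ G 0ℚ
Ric≥0⇐0≤Γ₂ G 0≤Γ₂ f x = subst (_≤ Γ₂ G f x) (sym (*-zeroˡ (Γ G f f x))) (0≤Γ₂ f x)

module _ {X : Set} (_∙_ : X → X → X) (S : List X) where

  Δ-Cayley : ∀ f x → Δ (Cayley _∙_ S) f x ≡ ∑ S (λ s → f (x ∙ s) - f x)
  Δ-Cayley f x = cong sumℚ (sym (map-∘ S))

  Γ-Cayley : ∀ f g x →
             Γ (Cayley _∙_ S) f g x ≡ ½ * ∑ S (λ s → (f x - f (x ∙ s)) * (g x - g (x ∙ s)))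
  Γ-Cayley f g x = cong (λ L → ½ * sumℚ L) (sym (map-∘ S))

  Γ₂-Cayley : ∀ f x → Γ₂ (Cayley _∙_ S) f x ≡
              ½ * ∑ S (λ s → ∑ S (λ t → Γ₂-summand (f x) (f (x ∙ s)) (f (x ∙ t)) (f ((x ∙ s) ∙ t))))
  Γ₂-Cayley f x = begin
    ½ * Δ G Γf x - Γ G f Δf x
      ≡⟨ cong₂ (λ p q → ½ * p - q) (Δ-Cayley Γf x) (Γ-Cayley f Δf x) ⟩
    ½ * ∑ S ΔΓf - ½ * ∑ S ΓΔf
      ≡⟨ sym (x[y-z]≈xy-xz ½ (∑ S ΔΓf) (∑ S ΓΔf)) ⟩
    ½ * (∑ S ΔΓf - ∑ S ΓΔf)
      ≡⟨ cong (½ *_) (sym (∑-- S ΔΓf ΓΔf)) ⟩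
    ½ * ∑ S (λ s → ΔΓf s - ΓΔf s)
      ≡⟨ cong (½ *_) (∑-cong S (λ s → sym (inner-sum s))) ⟩
    ½ * ∑ S (λ s → ∑ S (λ t → Γ₂-summand a (b s) (b t) (w s t)))  ∎
    where
    open ≡-Reasoning
    G : Graph
    G = Cayley _∙_ S
    Γf Δf : X → ℚ
    Γf = Γ G f f
    Δf = Δ G f
    a : ℚ
    a = f x
    b : X → ℚ
    b s = f (x ∙ s)
    w : X → X → ℚ
    w s t = f ((x ∙ s) ∙ t)
    ΔΓf ΓΔf : X → ℚ
    ΔΓf s = Γf (x ∙ s) - Γf x
    ΓΔf s = (a - b s) * (Δf x - Δf (x ∙ s))

    inner-sum : ∀ s → ∑ S (λ t → Γ₂-summand a (b s) (b t) (w s t)) ≡ ΔΓf s - ΓΔf s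
    inner-sum s = begin
      ∑ S (λ t → P t - (a - b s) * R t)
        ≡⟨ ∑-- S P (λ t → (a - b s) * R t) ⟩
      ∑ S P - ∑ S (λ t → (a - b s) * R t)
        ≡⟨ cong₂ _-_ (∑-- S (λ t → ½ * Q₁ t) (λ t → ½ * Q₂ t)) (∑-*ˡ S (a - b s) R) ⟩
      (∑ S (λ t → ½ * Q₁ t) - ∑ S (λ t → ½ * Q₂ t)) - (a - b s) * ∑ S R
        ≡⟨ cong₂ _-_ (cong₂ _-_ (∑-*ˡ S ½ Q₁) (∑-*ˡ S ½ Q₂))
                     (cong ((a - b s) *_) (∑-- S (λ t → b t - a) (λ t → w s t - b s))) ⟩
      (½ * ∑ S Q₁ - ½ * ∑ S Q₂) - (a - b s) * (∑ S (λ t → b t - a) - ∑ S (λ t → w s t - b s))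
        ≡⟨ cong₂ _-_ (cong₂ _-_ (sym (Γ-Cayley f f (x ∙ s))) (sym (Γ-Cayley f f x)))
                     (cong ((a - b s) *_) (cong₂ _-_ (sym (Δ-Cayley f x)) (sym (Δ-Cayley f (x ∙ s))))) ⟩
      ΔΓf s - ΓΔf s  ∎
      where
      Q₁ Q₂ P R : X → ℚ
      Q₁ t = (b s - w s t) * (b s - w s t)
      Q₂ t = (a - b t) * (a - b t)
      P t = ½ * Q₁ t - ½ * Q₂ t
      R t = (b t - a) - (w s t - b s)

  mixed-difference : (X → ℚ) → X → X → X → ℚ
  mixed-difference f x s t = f ((x ∙ s) ∙ t) - f (x ∙ s) - f (x ∙ t) + f x

  module _ (right-comm : ∀ x s t → (x ∙ s) ∙ t ≡ (x ∙ t) ∙ s) where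

    Γ₂-Cayley-right-comm : ∀ f x → Γ₂ (Cayley _∙_ S) f x ≡
      ½ * (½ * ∑ S (λ s → ∑ S (λ t → mixed-difference f x s t * mixed-difference f x s t)))
    Γ₂-Cayley-right-comm f x =
      trans (Γ₂-Cayley f x) (cong (½ *_) (trans (∑∑-symmetrise S summand)
        (cong (½ *_) (∑-cong S (λ s → ∑-cong S (λ t → summand-symmetrised s t))))))
      where
      summand : X → X → ℚ
      summand s t = Γ₂-summand (f x) (f (x ∙ s)) (f (x ∙ t)) (f ((x ∙ s) ∙ t))
      summand-symmetrised : ∀ s t →
        summand s t + summand t s ≡ mixed-difference f x s t * mixed-difference f x s t
      summand-symmetrised s t =
        trans (cong (λ y → summand s t + Γ₂-summand (f x) (f (x ∙ t)) (f (x ∙ s)) (f y)) (right-comm x t s))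
              (Γ₂-summand-symmetrised (f x) (f (x ∙ s)) (f (x ∙ t)) (f ((x ∙ s) ∙ t)))

    Ric≥0-Cayley : Ric≥ (Cayley _∙_ S) 0ℚ
    Ric≥0-Cayley = Ric≥0⇐0≤Γ₂ (Cayley _∙_ S) λ f x →
      subst (0ℚ ≤_) (sym (Γ₂-Cayley-right-comm f x))
        (0≤½*p (0≤½*p (∑-nonNeg S (λ s → ∑-nonNeg S (λ t → 0≤p*p (mixed-difference f x s t))))))
      where
      0≤½*p : ∀ {p} → 0ℚ ≤ p → 0ℚ ≤ ½ * p
      0≤½*p = *-monoˡ-≤-nonNeg ½

-- Only the commutativity and associativity of the group law enter: the curvature bound
-- holds for every finite list S, symmetric, generating and duplicate-free or not.
theorem5 : {X : Set} (_∙_ : X → X → X) (ε : X) (_⁻¹ : X → X) →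
    IsAbelianGroup _≡_ _∙_ ε _⁻¹ →
    (S : List X) → Unique S →
    (∀ {s} → s ∈ S → (s ⁻¹) ∈ S) →
    ¬ (ε ∈ S) →
    Generates _∙_ ε S →
    Ric≥ (Cayley _∙_ S) 0ℚ
theorem5 {X} _∙_ ε _⁻¹ isAbelianGroup S _ _ _ _ =
  Ric≥0-Cayley _∙_ S (xy∙z≈xz∙y ∙-commutativeSemigroup)
  where
  ∙-commutativeSemigroup : CommutativeSemigroup 0ℓ 0ℓ
  ∙-commutativeSemigroup = record
    { Carrier = X ; _≈_ = _≡_ ; _∙_ = _∙_
    ; isCommutativeSemigroup = IsAbelianGroup.isCommutativeSemigroup isAbelianGroup
    }
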